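{- An integer $n$ is admissible if and only if $n$ is even.
   Context: Let $\phi=\frac{1+\sqrt5}{2}$ and let $\Gamma^+$ be the semigroup generated by the matrices $\begin{pmatrix}1&\phi\\0&1\end{pmatrix}$, $\begin{pmatrix}1&0\\\phi&1\end{pmatrix}$, $\begin{pmatrix}\phi&\phi\\1&\phi\end{pmatrix}$, $\begin{pmatrix}\phi&1\\\phi&\phi\end{pmatrix}$. For $\gamma\in\Gamma^+$, write $\gamma\cdot(0,1)^t=(a+b\phi,\ c+d\phi)^t$ with $a,b,c,d\in\mathbb Z$ (uniquely determined since $\phi$ is irrational), and set $\ell=a+b+c+d$. Define $\mathcal L(\gamma)=2\ell$ if $(d-b)+2(c-a)\equiv 0 \pmod 5$, and $\mathcal L(\gamma)=10\ell$ otherwise. (This is the combinatorial period length of the pentagon billiard trajectory associated to $\gamma$.) An integer $n$ is called admissible if for every integer $q\ge1$ there exists $\gamma\in\Gamma^+$ with $\mathcal L(\gamma)\equiv n\pmod q$. -}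

module Defs where

open import Data.Nat using (ℕ) renaming (_≟_ to _≟ℕ_)
open import Data.Integer using (ℤ; +_; _+_; _*_; _-_)
open import Data.Integer.DivMod using (_%ℕ_)
open import Data.Integer.Divisibility using (_∣_)
open import Data.Product using (Σ; _×_; _,_)
open import Relation.Nullary using (yes; no)

-- Elements of ℤ[φ]: a pair (a , b) represents a + b φ, where φ² = φ + 1.
-- Since φ is irrational this representation is unique.
record ℤφ : Set where
  constructor _+_φ
  field
    re : ℤ
    ph : ℤ
open ℤφ public

infixl 6 _⊕_
infixl 7 _⊗_

_⊕_ : ℤφ → ℤφ → ℤφ
(a + b φ) ⊕ (c + d φ) = (a + c) + (b + d) φ

-- (a + bφ)(c + dφ) = ac + (ad + bc)φ + bd φ² = (ac + bd) + (ad + bc + bd) φ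
_⊗_ : ℤφ → ℤφ → ℤφ
(a + b φ) ⊗ (c + d φ) = (a * c + b * d) + (a * d + b * c + b * d) φ

𝟘 𝟙 Φ : ℤφ
𝟘 = (+ 0) + (+ 0) φ
𝟙 = (+ 1) + (+ 0) φ
Φ = (+ 0) + (+ 1) φ

record Mat : Set where
  constructor mat
  field
    m11 m12 m21 m22 : ℤφ
open Mat public

_·_ : Mat → Mat → Mat
mat a b c d · mat e f g h =
  mat (a ⊗ e ⊕ b ⊗ g) (a ⊗ f ⊕ b ⊗ h) (c ⊗ e ⊕ d ⊗ g) (c ⊗ f ⊕ d ⊗ h)

g₁ g₂ g₃ g₄ : Mat
g₁ = mat 𝟙 Φ 𝟘 𝟙
g₂ = mat 𝟙 𝟘 Φ 𝟙
g₃ = mat Φ Φ 𝟙 Φ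
g₄ = mat Φ 𝟙 Φ Φ

data Γ⁺ : Mat → Set where
  gen₁ : Γ⁺ g₁
  gen₂ : Γ⁺ g₂
  gen₃ : Γ⁺ g₃
  gen₄ : Γ⁺ g₄
  mul  : ∀ {γ δ} → Γ⁺ γ → Γ⁺ δ → Γ⁺ (γ · δ)

-- γ · (0,1)ᵗ is the second column (m12 , m22) = (a + bφ , c + dφ).
-- ℓ = a + b + c + d ;  L = 2ℓ if (d - b) + 2(c - a) ≡ 0 (mod 5), else 10ℓ.
ℓ : Mat → ℤ
ℓ γ = re (m12 γ) + ph (m12 γ) + re (m22 γ) + ph (m22 γ)

𝓛 : Mat → ℤ
𝓛 γ with ((ph (m22 γ) - ph (m12 γ)) + (+ 2) * (re (m22 γ) - re (m12 γ))) %ℕ 5 ≟ℕ 0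
... | yes _ = (+ 2)  * ℓ γ
... | no  _ = (+ 10) * ℓ γ

Admissible : ℤ → Set
Admissible n = (q : ℕ) → 1 Data.Nat.≤ q → Σ Mat (λ γ → Γ⁺ γ × (+ q) ∣ (𝓛 γ - n))

{-# OPTIONS --safe #-}
-- Since 𝓛 γ is 2 ℓ γ or 10 ℓ γ, admissible integers are even.  Conversely, write
-- κ = (d − b) + 2 (c − a), so that 𝓛 = 2 ℓ whenever 5 ∣ κ.  Modulo N the semigroup
-- contains g₁ᵏ and g₂ᵏ for every integer k (take the exponent k mod N), so the
-- columns γ · (0,1)ᵗ reachable modulo N are closed under all integer shears.  Along
-- five explicit affine lines of such columns, one for each residue r mod 5, ℓ runs
-- through r + 5j while 5 ∣ κ; with N = 5q this makes 𝓛 hit every even residue mod q.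
module Submission where

open import Defs
open import Data.Integer.Base
  using (ℤ; +_; 0ℤ; 1ℤ; -1ℤ; _+_; _*_; _-_; -_; _%ℕ_; _/ℕ_)
open import Data.Integer.Properties using (neg-involutive; *-identityʳ)
open import Data.Integer.DivMod using (a≡a%ℕn+[a/ℕn]*n; n%ℕd<d)
open import Data.Integer.Divisibility using (_∣_)
open import Data.Integer.Divisibility.Signed
  using (divides; ∣ᵤ⇒∣; ∣⇒∣ᵤ; ∣-refl; ∣-trans; ∣m∣n⇒∣m+n; ∣m+n∣m⇒∣n; ∣m+n∣n⇒∣m;
         ∣m⇒∣-m; ∣n⇒∣m*n; ∣m⇒∣m*n)
  renaming (_∣_ to _∣ˢ_)
open import Data.Integer.Tactic.RingSolver using (solve; solve-∀)
open import Data.List.Base using (List; []; _∷_)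
open import Data.Nat.Base as ℕ using (ℕ; zero; suc; NonZero; s≤s; z≤n)
open import Data.Nat.DivMod using (m<n⇒m%n≡m)
open import Data.Nat.Divisibility using (n∣m⇒m%n≡0; m∣m*n; n∣m*n)
open import Data.Nat.Properties using (_≟_)
open import Data.Product.Base using (_×_; _,_; Σ; ∃-syntax)
open import Relation.Binary.PropositionalEquality
  using (_≡_; refl; sym; trans; cong; cong₂; subst; module ≡-Reasoning)
open import Relation.Nullary.Decidable.Core using (yes; no)
open import Relation.Nullary.Negation using (contradiction)

data Column : Set where
  col : (a b c d : ℤ) → Column

column : Mat → Column
column γ = col (re (m12 γ)) (ph (m12 γ)) (re (m22 γ)) (ph (m22 γ))

col-cong : ∀ {a b c d a′ b′ c′ d′} →
           a ≡ a′ → b ≡ b′ → c ≡ c′ → d ≡ d′ → col a b c d ≡ col a′ b′ c′ d′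
col-cong refl refl refl refl = refl

infixl 6 _⊞_
infixr 7 _⊡_

_⊞_ : Column → Column → Column
col a b c d ⊞ col a′ b′ c′ d′ = col (a + a′) (b + b′) (c + c′) (d + d′)

_⊡_ : ℤ → Column → Column
k ⊡ col a b c d = col (k * a) (k * b) (k * c) (k * d)

ℓᶜ κ : Column → ℤ
ℓᶜ (col a b c d) = a + b + c + d
κ  (col a b c d) = (d - b) + + 2 * (c - a)

ℓᶜ-linear : ∀ v k w → ℓᶜ (v ⊞ k ⊡ w) ≡ ℓᶜ v + k * ℓᶜ w
ℓᶜ-linear (col a b c d) k (col a′ b′ c′ d′) = identity a b c d a′ b′ c′ d′ k
  where
  identity : ∀ a b c d a′ b′ c′ d′ k →
             (a + k * a′) + (b + k * b′) + (c + k * c′) + (d + k * d′)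
             ≡ (a + b + c + d) + k * (a′ + b′ + c′ + d′)
  identity = solve-∀

κ-linear : ∀ v k w → κ (v ⊞ k ⊡ w) ≡ κ v + k * κ w
κ-linear (col a b c d) k (col a′ b′ c′ d′) = identity a b c d a′ b′ c′ d′ k
  where
  identity : ∀ a b c d a′ b′ c′ d′ k →
             ((d + k * d′) - (b + k * b′)) + + 2 * ((c + k * c′) - (a + k * a′))
             ≡ ((d - b) + + 2 * (c - a)) + k * ((d′ - b′) + + 2 * (c′ - a′))
  identity = solve-∀

infix 4 _≈_mod_

_≈_mod_ : Column → Column → ℤ → Set
v ≈ w mod n = ∃[ x ] v ≡ w ⊞ n ⊡ x

≈-refl : ∀ {n} v → v ≈ v mod n
≈-refl {n} (col a b c d) = col 0ℤ 0ℤ 0ℤ 0ℤ , col-cong (solve vs) (solve vs) (solve vs) (solve vs)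
  where vs = a ∷ b ∷ c ∷ d ∷ n ∷ []

≈-trans : ∀ {n u v w} → u ≈ v mod n → v ≈ w mod n → u ≈ w mod n
≈-trans {n} {w = w} (x , refl) (y , refl) = y ⊞ x , regroup w y x
  where
  regroup : ∀ w y x → (w ⊞ n ⊡ y) ⊞ n ⊡ x ≡ w ⊞ n ⊡ (y ⊞ x)
  regroup (col a b c d) (col a′ b′ c′ d′) (col a″ b″ c″ d″) =
    col-cong (solve vs) (solve vs) (solve vs) (solve vs)
    where vs = a ∷ b ∷ c ∷ d ∷ a′ ∷ b′ ∷ c′ ∷ d′ ∷ a″ ∷ b″ ∷ c″ ∷ d″ ∷ n ∷ []

data Shear : Set where
  upper lower : Shear

generator : Shear → Mat
generator upper = g₁
generator lower = g₂

generator-Γ⁺ : ∀ X → Γ⁺ (generator X)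
generator-Γ⁺ upper = gen₁
generator-Γ⁺ lower = gen₂

-- g₁ᵏ = I + k φ E₁₂ and g₂ᵏ = I + k φ E₂₁ act on columns as id + k · nil.
nil : Shear → Column → Column
nil upper (col a b c d) = col d (c + d) 0ℤ 0ℤ
nil lower (col a b c d) = col 0ℤ 0ℤ b (a + b)

shear : Shear → ℤ → Column → Column
shear X k v = v ⊞ k ⊡ nil X v

-- The entries are spelled out as _·_ computes them: the ring solver cannot look
-- through the record projections of Defs.
column-generator : ∀ X M → column (generator X · M) ≡ shear X 1ℤ (column M)
column-generator upper (mat _ (a + b φ) _ (c + d φ)) = col-cong e₁ e₂ e₃ e₄
  where
  vs = a ∷ b ∷ c ∷ d ∷ []
  e₁ : (+ 1 * a + + 0 * b) + (+ 0 * c + + 1 * d) ≡ a + 1ℤ * d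
  e₁ = solve vs
  e₂ : (+ 1 * b + + 0 * a + + 0 * b) + (+ 0 * d + + 1 * c + + 1 * d) ≡ b + 1ℤ * (c + d)
  e₂ = solve vs
  e₃ : (+ 0 * a + + 0 * b) + (+ 1 * c + + 0 * d) ≡ c + 1ℤ * 0ℤ
  e₃ = solve vs
  e₄ : (+ 0 * b + + 0 * a + + 0 * b) + (+ 1 * d + + 0 * c + + 0 * d) ≡ d + 1ℤ * 0ℤ
  e₄ = solve vs
column-generator lower (mat _ (a + b φ) _ (c + d φ)) = col-cong e₁ e₂ e₃ e₄
  where
  vs = a ∷ b ∷ c ∷ d ∷ []
  e₁ : (+ 1 * a + + 0 * b) + (+ 0 * c + + 0 * d) ≡ a + 1ℤ * 0ℤ
  e₁ = solve vs
  e₂ : (+ 1 * b + + 0 * a + + 0 * b) + (+ 0 * d + + 0 * c + + 0 * d) ≡ b + 1ℤ * 0ℤ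
  e₂ = solve vs
  e₃ : (+ 0 * a + + 1 * b) + (+ 1 * c + + 0 * d) ≡ c + 1ℤ * b
  e₃ = solve vs
  e₄ : (+ 0 * b + + 1 * a + + 1 * b) + (+ 1 * d + + 0 * c + + 0 * d) ≡ d + 1ℤ * (a + b)
  e₄ = solve vs

shear-shear : ∀ X j k v → shear X j (shear X k v) ≡ shear X (j + k) v
shear-shear upper j k (col a b c d) = col-cong (solve vs) (solve vs) (solve vs) (solve vs)
  where vs = a ∷ b ∷ c ∷ d ∷ j ∷ k ∷ []
shear-shear lower j k (col a b c d) = col-cong (solve vs) (solve vs) (solve vs) (solve vs)
  where vs = a ∷ b ∷ c ∷ d ∷ j ∷ k ∷ []

shear-zero : ∀ X v → shear X 0ℤ v ≡ v
shear-zero upper (col a b c d) = col-cong (solve vs) (solve vs) (solve vs) (solve vs)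
  where vs = a ∷ b ∷ c ∷ d ∷ []
shear-zero lower (col a b c d) = col-cong (solve vs) (solve vs) (solve vs) (solve vs)
  where vs = a ∷ b ∷ c ∷ d ∷ []

shear-linear : ∀ X k v t x → shear X k (v ⊞ t ⊡ x) ≡ shear X k v ⊞ t ⊡ shear X k x
shear-linear upper k (col a b c d) t (col a′ b′ c′ d′) =
  col-cong (solve vs) (solve vs) (solve vs) (solve vs)
  where vs = a ∷ b ∷ c ∷ d ∷ a′ ∷ b′ ∷ c′ ∷ d′ ∷ k ∷ t ∷ []
shear-linear lower k (col a b c d) t (col a′ b′ c′ d′) =
  col-cong (solve vs) (solve vs) (solve vs) (solve vs)
  where vs = a ∷ b ∷ c ∷ d ∷ a′ ∷ b′ ∷ c′ ∷ d′ ∷ k ∷ t ∷ []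

shear-+ : ∀ X k i v → shear X (k + i) v ≡ shear X k v ⊞ i ⊡ nil X v
shear-+ upper k i (col a b c d) = col-cong (solve vs) (solve vs) (solve vs) (solve vs)
  where vs = a ∷ b ∷ c ∷ d ∷ k ∷ i ∷ []
shear-+ lower k i (col a b c d) = col-cong (solve vs) (solve vs) (solve vs) (solve vs)
  where vs = a ∷ b ∷ c ∷ d ∷ k ∷ i ∷ []

shear-≈-exponent : ∀ X k i n v → shear X k v ≈ shear X (k + i * n) v mod n
shear-≈-exponent upper k i n v@(col a b c d) =
  - i ⊡ nil upper v , col-cong (solve vs) (solve vs) (solve vs) (solve vs)
  where vs = a ∷ b ∷ c ∷ d ∷ k ∷ i ∷ n ∷ []
shear-≈-exponent lower k i n v@(col a b c d) =
  - i ⊡ nil lower v , col-cong (solve vs) (solve vs) (solve vs) (solve vs)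
  where vs = a ∷ b ∷ c ∷ d ∷ k ∷ i ∷ n ∷ []

power : Shear → ℕ → Mat → Mat
power X zero    M = M
power X (suc n) M = generator X · power X n M

power-Γ⁺ : ∀ X n {M} → Γ⁺ M → Γ⁺ (power X n M)
power-Γ⁺ X zero    M∈Γ⁺ = M∈Γ⁺
power-Γ⁺ X (suc n) M∈Γ⁺ = mul (generator-Γ⁺ X) (power-Γ⁺ X n M∈Γ⁺)

column-power : ∀ X n M → column (power X n M) ≡ shear X (+ n) (column M)
column-power X zero    M = sym (shear-zero X (column M))
column-power X (suc n) M = begin
  column (generator X · power X n M)     ≡⟨ column-generator X (power X n M) ⟩
  shear X 1ℤ (column (power X n M))      ≡⟨ cong (shear X 1ℤ) (column-power X n M) ⟩
  shear X 1ℤ (shear X (+ n) (column M))  ≡⟨ shear-shear X 1ℤ (+ n) (column M) ⟩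
  shear X (+ suc n) (column M)           ∎
  where open ≡-Reasoning

Reachable : ℕ → Column → Set
Reachable N v = ∃[ γ ] Γ⁺ γ × column γ ≈ v mod + N

reachable-g₁ : ∀ N → Reachable N (column g₁)
reachable-g₁ N = g₁ , gen₁ , ≈-refl (column g₁)

shear-≈ : ∀ {n v w} X k → v ≈ w mod n → shear X k v ≈ shear X k w mod n
shear-≈ {n} {w = w} X k (x , refl) = shear X k x , shear-linear X k w n x

-- A negative exponent k is realised by the power k mod N, which has the same column modulo N.
reachable-shear : ∀ {N} .{{_ : NonZero N}} X k {v} → Reachable N v → Reachable N (shear X k v)
reachable-shear {N} X k {v} (γ , γ∈Γ⁺ , γ≈v) =
  power X r γ , power-Γ⁺ X r γ∈Γ⁺ , ≈-trans power≈ exponent≈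
  where
  r = k %ℕ N
  power≈ : column (power X r γ) ≈ shear X (+ r) v mod + N
  power≈ = subst (_≈ shear X (+ r) v mod + N) (sym (column-power X r γ)) (shear-≈ X (+ r) γ≈v)
  exponent≈ : shear X (+ r) v ≈ shear X k v mod + N
  exponent≈ = subst (λ k′ → shear X (+ r) v ≈ shear X k′ v mod + N) (sym (a≡a%ℕn+[a/ℕn]*n k N))
                    (shear-≈-exponent X (+ r) (k /ℕ N) (+ N) v)

Word : Set
Word = List (Shear × ℤ)

act : Word → Column → Column
act []              v = v
act ((X , k) ∷ w) v = shear X k (act w v)

act-linear : ∀ w v t x → act w (v ⊞ t ⊡ x) ≡ act w v ⊞ t ⊡ act w x
act-linear []              v t x = refl
act-linear ((X , k) ∷ w) v t x =
  trans (cong (shear X k) (act-linear w v t x)) (shear-linear X k (act w v) t (act w x))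

reachable-act : ∀ {N} .{{_ : NonZero N}} w {v} → Reachable N v → Reachable N (act w v)
reachable-act []              reach = reach
reachable-act ((X , k) ∷ w) reach = reachable-shear X k (reachable-act w reach)

record Line : Set where
  constructor line
  field
    outer  : Word
    pivot  : Shear
    offset : ℤ
    inner  : Word

  start : Column
  start = act inner (column g₁)

  point : ℤ → Column
  point j = act outer (shear pivot (offset + j * + 5) start)

  base direction : Column
  base      = act outer (shear pivot offset start)
  direction = act outer (nil pivot start)

  point-affine : ∀ j → point j ≡ base ⊞ (j * + 5) ⊡ direction
  point-affine j = trans (cong (act outer) (shear-+ pivot offset (j * + 5) start))
                         (act-linear outer (shear pivot offset start) (j * + 5) (nil pivot start))

  point-reachable : ∀ N .{{_ : NonZero N}} j → Reachable N (point j)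
  point-reachable N j =
    reachable-act outer (reachable-shear pivot (offset + j * + 5) (reachable-act inner (reachable-g₁ N)))

record Covers (r : ℕ) (L : Line) : Set where
  open Line L
  field
    ℓ-base      : ℓᶜ base ≡ + r
    ℓ-direction : ℓᶜ direction ≡ 1ℤ
    5∣κ-base    : + 5 ∣ˢ κ base

  ℓ-point : ∀ j → ℓᶜ (point j) ≡ + r + j * + 5
  ℓ-point j = begin
    ℓᶜ (point j)                                  ≡⟨ cong ℓᶜ (point-affine j) ⟩
    ℓᶜ (base ⊞ (j * + 5) ⊡ direction)             ≡⟨ ℓᶜ-linear base (j * + 5) direction ⟩
    ℓᶜ base + (j * + 5) * ℓᶜ direction            ≡⟨ cong₂ (λ x y → x + (j * + 5) * y) ℓ-base ℓ-direction ⟩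
    + r + (j * + 5) * 1ℤ                          ≡⟨ cong (_+_ (+ r)) (*-identityʳ (j * + 5)) ⟩
    + r + j * + 5                                 ∎
    where open ≡-Reasoning

  5∣κ-point : ∀ j → + 5 ∣ˢ κ (point j)
  5∣κ-point j = subst (+ 5 ∣ˢ_) (sym κ-point)
                      (∣m∣n⇒∣m+n 5∣κ-base (∣m⇒∣m*n (κ direction) (∣n⇒∣m*n j ∣-refl)))
    where
    κ-point : κ (point j) ≡ κ base + (j * + 5) * κ direction
    κ-point = trans (cong κ (point-affine j)) (κ-linear base (j * + 5) direction)

-- One line for each residue r of ℓ mod 5; the words were found by a computer search.
covering : ∀ r → r ℕ.< 5 → Σ Line (Covers r)
covering 0 _ = line ((lower , -1ℤ) ∷ (upper , 1ℤ) ∷ (lower , 1ℤ) ∷ []) upper 1ℤ ((lower , -1ℤ) ∷ [])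
             , record { ℓ-base = refl ; ℓ-direction = refl ; 5∣κ-base = divides (+ 3) refl }
covering 1 _ = line ((upper , -1ℤ) ∷ []) lower (+ 2) ((upper , - + 2) ∷ [])
             , record { ℓ-base = refl ; ℓ-direction = refl ; 5∣κ-base = divides (- + 2) refl }
covering 2 _ = line ((upper , -1ℤ) ∷ []) lower (+ 2) ((upper , 1ℤ) ∷ (lower , -1ℤ) ∷ [])
             , record { ℓ-base = refl ; ℓ-direction = refl ; 5∣κ-base = divides (- + 2) refl }
covering 3 _ = line [] upper 1ℤ []
             , record { ℓ-base = refl ; ℓ-direction = refl ; 5∣κ-base = divides 0ℤ refl }
covering 4 _ = line ((lower , -1ℤ) ∷ (upper , 1ℤ) ∷ (lower , -1ℤ) ∷ []) upper (+ 5) ((lower , -1ℤ) ∷ [])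
             , record { ℓ-base = refl ; ℓ-direction = refl ; 5∣κ-base = divides (- + 5) refl }
covering (suc (suc (suc (suc (suc _))))) (s≤s (s≤s (s≤s (s≤s (s≤s ())))))

∣ˢ⇒%ℕ≡0 : ∀ {d} .{{_ : NonZero d}} {x} → + d ∣ˢ x → x %ℕ d ≡ 0
∣ˢ⇒%ℕ≡0 {d} {x} d∣x = trans (sym (m<n⇒m%n≡m (n%ℕd<d x d))) (n∣m⇒m%n≡0 r d (∣⇒∣ᵤ d∣r))
  where
  r = x %ℕ d
  d∣r : + d ∣ˢ + r
  d∣r = ∣m+n∣n⇒∣m (subst (+ d ∣ˢ_) (a≡a%ℕn+[a/ℕn]*n x d) d∣x) (∣n⇒∣m*n (x /ℕ d) ∣-refl)

𝓛-even : ∀ γ → + 2 ∣ˢ 𝓛 γ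
𝓛-even γ with κ (column γ) %ℕ 5 ≟ 0
... | yes _ = ∣m⇒∣m*n (ℓ γ) ∣-refl
... | no  _ = ∣m⇒∣m*n (ℓ γ) (divides (+ 5) refl)

𝓛≡2ℓ : ∀ γ → + 5 ∣ˢ κ (column γ) → 𝓛 γ ≡ + 2 * ℓ γ
𝓛≡2ℓ γ 5∣κ with κ (column γ) %ℕ 5 ≟ 0
... | yes _   = refl
... | no  κ≢0 = contradiction (∣ˢ⇒%ℕ≡0 5∣κ) κ≢0

length-hits : ∀ m N .{{_ : NonZero N}} → + 5 ∣ˢ + N →
              ∃[ γ ] Γ⁺ γ × + 5 ∣ˢ κ (column γ) × + N ∣ˢ ℓ γ - m
length-hits m N 5∣N with covering (m %ℕ 5) (n%ℕd<d m 5)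
... | L , covers with Line.point-reachable L N (m /ℕ 5)
... | γ , γ∈Γ⁺ , x , γ≡ = γ , γ∈Γ⁺ , 5∣κ , divides (ℓᶜ x) ℓ-m
  where
  open Line L
  open Covers covers
  j = m /ℕ 5
  ℓγ : ℓ γ ≡ m + + N * ℓᶜ x
  ℓγ = begin
    ℓᶜ (column γ)                ≡⟨ cong ℓᶜ γ≡ ⟩
    ℓᶜ (point j ⊞ + N ⊡ x)       ≡⟨ ℓᶜ-linear (point j) (+ N) x ⟩
    ℓᶜ (point j) + + N * ℓᶜ x    ≡⟨ cong (λ y → y + + N * ℓᶜ x) (ℓ-point j) ⟩
    + (m %ℕ 5) + j * + 5 + + N * ℓᶜ x
                                 ≡⟨ cong (λ y → y + + N * ℓᶜ x) (a≡a%ℕn+[a/ℕn]*n m 5) ⟨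
    m + + N * ℓᶜ x               ∎
    where open ≡-Reasoning
  cancel : ∀ m n y → (m + n * y) - m ≡ y * n
  cancel = solve-∀
  ℓ-m : ℓ γ - m ≡ ℓᶜ x * + N
  ℓ-m = trans (cong (_- m) ℓγ) (cancel m (+ N) (ℓᶜ x))
  5∣κ : + 5 ∣ˢ κ (column γ)
  5∣κ = subst (+ 5 ∣ˢ_) (sym (trans (cong κ γ≡) (κ-linear (point j) (+ N) x)))
              (∣m∣n⇒∣m+n (5∣κ-point j) (∣m⇒∣m*n (κ x) 5∣N))

admissible⇒even : ∀ n → Admissible n → + 2 ∣ n
admissible⇒even n admissible =
  let γ , _ , 2∣𝓛-n = admissible 2 (s≤s z≤n)
      2∣-n = ∣m+n∣m⇒∣n (∣ᵤ⇒∣ {+ 2} {𝓛 γ - n} 2∣𝓛-n) (𝓛-even γ)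
  in ∣⇒∣ᵤ {+ 2} {n} (subst (+ 2 ∣ˢ_) (neg-involutive n) (∣m⇒∣-m 2∣-n))

𝓛-hits : ∀ m q → ∃[ γ ] Γ⁺ γ × + suc q ∣ 𝓛 γ - m * + 2
𝓛-hits m q =
  let γ , γ∈Γ⁺ , 5∣κ , 5q∣ℓ-m = length-hits m (5 ℕ.* suc q) (∣ᵤ⇒∣ (m∣m*n (suc q)))
      q∣2[ℓ-m] = ∣m⇒∣m*n (+ 2) (∣-trans (∣ᵤ⇒∣ (n∣m*n 5)) 5q∣ℓ-m)
  in γ , γ∈Γ⁺ , ∣⇒∣ᵤ {+ suc q} {𝓛 γ - m * + 2} (subst (+ suc q ∣ˢ_) (sym (𝓛-m≡ γ 5∣κ)) q∣2[ℓ-m])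
  where
  double : ∀ l m → + 2 * l - m * + 2 ≡ (l - m) * + 2
  double = solve-∀
  𝓛-m≡ : ∀ γ → + 5 ∣ˢ κ (column γ) → 𝓛 γ - m * + 2 ≡ (ℓ γ - m) * + 2
  𝓛-m≡ γ 5∣κ = trans (cong (_- m * + 2) (𝓛≡2ℓ γ 5∣κ)) (double (ℓ γ) m)

even⇒admissible : ∀ {n} → + 2 ∣ˢ n → Admissible n
even⇒admissible (divides m refl) (suc q) _ = 𝓛-hits m q

theorem1p4 : (n : ℤ) → (Admissible n → (+ 2) ∣ n) × ((+ 2) ∣ n → Admissible n)
theorem1p4 n = admissible⇒even n , λ 2∣n → even⇒admissible (∣ᵤ⇒∣ {+ 2} {n} 2∣n)
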